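{- If $T$ is an undirected tree with diameter $d(T)$, then $\tau(T,\text{all paths},d(T))\le2$.
   Context: A labeling of $T=(V,E)$ is a map $\lambda:E\to 2^{\mathbb{N}}$; $\lambda_{\min},\lambda_{\max}$ are the minimum and maximum labels used and the age is $\alpha(\lambda)=\lambda_{\max}-\lambda_{\min}+1$; $\mathcal{L}_{T,k}$ is the set of labelings of age at most $k$. A simple path traversed from one endpoint to the other through edges $e_1,\dots,e_k$ is preserved by $\lambda$ if there are labels $l_1<\dots<l_k$ with $l_i\in\lambda(e_i)$. all-paths$(T)$ is the set of labelings preserving every simple path of $T$ in each of its two traversal directions. $\tau(T,\text{all paths},k)=\min_{\lambda\in\text{all-paths}(T)\cap\mathcal{L}_{T,k}}\max_{e\in E}|\lambda(e)|$. $d(T)$ is the diameter of $T$ (number of edges of a longest shortest path). -}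

module Defs where

open import Data.Nat using (ℕ; zero; suc; _+_; _∸_; _≤_; _<_; _⊔_; _⊓_)
open import Data.Fin using (Fin)
open import Data.Product using (Σ; ∃; _×_; _,_)
open import Data.Sum using (_⊎_)
open import Data.List using (List; []; _∷_; length; concatMap; foldr)
open import Data.List.Membership.Propositional using (_∈_)
open import Data.List.Relation.Unary.Unique.Propositional using (Unique)
open import Data.List.Relation.Unary.Linked using (Linked)
open import Data.List.Relation.Binary.Pointwise using (Pointwise)
open import Data.List using (allFin)
open import Relation.Binary.PropositionalEquality using (_≡_)
open import Relation.Nullary using (¬_)

-- A finite (multi)graph with vertex set Fin n and edge set Fin m;
-- edge e has endpoints ends e (unordered: orientation is irrelevant below).
record Graph (n m : ℕ) : Set where
  field
    ends : Fin m → Fin n × Fin n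

module _ {n m : ℕ} (G : Graph n m) where
  open Graph G

  Joins : Fin m → Fin n → Fin n → Set
  Joins e u w = (ends e ≡ (u , w)) ⊎ (ends e ≡ (w , u))

  -- Walk u v es vs : a walk from u to v traversing the edges es in order,
  -- visiting the vertices vs in order (vs includes both endpoints).
  data Walk : Fin n → Fin n → List (Fin m) → List (Fin n) → Set where
    here : ∀ {u} → Walk u u [] (u ∷ [])
    step : ∀ {e u w v es vs} → Joins e u w → Walk w v es vs →
           Walk u v (e ∷ es) (u ∷ vs)

  SimplePath : Fin n → Fin n → List (Fin m) → Set
  SimplePath u v es = Σ (List (Fin n)) λ vs → Walk u v es vs × Unique vs

  Connected : Set
  Connected = ∀ u v → Σ (List (Fin m)) λ es → Σ (List (Fin n)) λ vs → Walk u v es vs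

  -- a cycle: closed walk of length ≥ 1 with pairwise distinct edges and
  -- pairwise distinct vertices (apart from start = end)
  HasCycle : Set
  HasCycle = Σ (Fin n) λ u → Σ (Fin m) λ e → Σ (List (Fin m)) λ es →
             Σ (List (Fin n)) λ ws →
             Walk u u (e ∷ es) (u ∷ ws) × Unique (e ∷ es) × Unique ws

  Acyclic : Set
  Acyclic = ¬ HasCycle

  IsDist : Fin n → Fin n → ℕ → Set
  IsDist u v k =
    (Σ (List (Fin m)) λ es → Σ (List (Fin n)) λ vs → Walk u v es vs × length es ≡ k) ×
    (∀ es vs → Walk u v es vs → k ≤ length es)

  IsDiameter : ℕ → Set
  IsDiameter D = (Σ (Fin n) λ u → Σ (Fin n) λ v → IsDist u v D) ×
                 (∀ u v k → IsDist u v k → k ≤ D)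

IsTree : ∀ {n m} → Graph n m → Set
IsTree {n} G = (0 < n) × Connected G × Acyclic G

-- A labeling assigns to each edge a finite set of labels, represented as a
-- duplicate-free list (so |λ(e)| = length (λ e)).
Labeling : ℕ → Set
Labeling m = Fin m → List ℕ

IsSetLabeling : ∀ {m} → Labeling m → Set
IsSetLabeling {m} λ′ = ∀ (e : Fin m) → Unique (λ′ e)

allLabels : ∀ {m} → Labeling m → List ℕ
allLabels {m} λ′ = concatMap λ′ (allFin m)

-- age = λmax − λmin + 1 (and 0 if no label is used at all)
age : ∀ {m} → Labeling m → ℕ
age λ′ with allLabels λ′
... | [] = 0
... | x ∷ xs = suc (foldr _⊔_ x xs ∸ foldr _⊓_ x xs)

Preserves : ∀ {m} → Labeling m → List (Fin m) → Set
Preserves λ′ es = Σ (List ℕ) λ ls → Pointwise (λ l e → l ∈ λ′ e) ls es × Linked _<_ ls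

AllPaths : ∀ {n m} → Graph n m → Labeling m → Set
AllPaths G λ′ = ∀ u v es → SimplePath G u v es → Preserves λ′ es

module Submission where

-- For adjacent vertices x, y let height x y be the length of a longest
-- simple path that ends at x and avoids y (the depth of the branch hanging
-- at x once the edge xy is cut).  Give the edge {a, b} the label set
-- { height a b , height b a }, and read the edge with the label height u w
-- when it is traversed from u to w.  Along a simple path u — x — b the label
-- strictly increases, height u x < height x b: a longest arm at u avoiding x,
-- followed by the edge ux, is an arm at x avoiding b (in a tree, b is not on
-- it).  Appending the edge xy to a longest arm at x avoiding y yields a simple
-- path, so height x y + 1 ≤ D; all labels lie in [0, D-1] and the age is ≤ D.

open import Defs
open import Data.Nat using (ℕ; suc; _≤_; _<_; _⊔_; _⊓_; z≤n; s≤s) renaming (_≟_ to _≟ℕ_)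
open import Data.Nat.Properties using (≤-trans; ≤-reflexive; m≤n+m; m≤n⇒m≤1+n; m∸n≤m; ⊔-lub; +-comm; ≤-totalOrder)
open import Data.Fin using (Fin) renaming (_≟_ to _≟F_)
open import Data.Product using (Σ; _×_; _,_; proj₁; proj₂; swap)
open import Data.Product.Properties using (,-injective)
open import Data.Sum using (_⊎_; inj₁; inj₂)
open import Data.List using (List; []; _∷_; length; _++_; drop; foldr; allFin; map; filter)
open import Data.List.Properties using (length-++; ∷-injectiveˡ; ∷ʳ-injectiveˡ; foldr-preservesᵇ)
open import Data.List.Membership.Propositional using (_∈_; _∉_)
open import Data.List.Membership.Propositional.Properties using (∈-++⁺ˡ; ∈-++⁺ʳ; ∈-++⁻; ∈-map⁺; ∈-filter⁺; ∈-allFin; ∈-concatMap⁻)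
open import Data.List.Relation.Binary.Subset.Propositional using (_⊆_)
open import Data.List.Relation.Unary.Any using (here; there; any?; satisfied)
open import Data.List.Relation.Unary.All using (All; lookup; tabulate)
open import Data.List.Relation.Unary.All.Properties using (¬Any⇒All¬; all-filter)
open import Data.List.Relation.Unary.AllPairs using ([]; _∷_)
open import Data.List.Relation.Unary.Unique.Propositional using (Unique)
open import Data.List.Relation.Unary.Unique.Propositional.Properties using (++⁺) renaming (Unique[x∷xs]⇒x∉xs to head∉tail)
open import Data.List.Relation.Unary.Linked using (Linked; []; [-]; _∷_)
open import Data.List.Relation.Binary.Pointwise using (Pointwise; []; _∷_)
open import Data.List.Extrema ≤-totalOrder using (argmax; argmax-all; f[xs]≤f[argmax])
open import Data.Empty using (⊥-elim)
open import Function using (_∘_)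
open import Relation.Binary.PropositionalEquality using (_≡_; _≢_; refl; sym; trans; cong; subst)
open import Relation.Nullary using (yes; no; ¬?)
open import Relation.Unary using (Decidable)

module _ {A : Set} where

  -- the introduction rule for Unique on a cons (the library only has its converse)
  unique-∷ : ∀ {x : A} {xs} → x ∉ xs → Unique xs → Unique (x ∷ xs)
  unique-∷ {xs = xs} x∉xs u = ¬Any⇒All¬ xs x∉xs ∷ u

  unique-[_] : ∀ (x : A) → Unique (x ∷ [])
  unique-[ x ] = unique-∷ (λ ()) []

  unique-pair : ∀ {x y : A} → x ≢ y → Unique (x ∷ y ∷ [])
  unique-pair x≢y = unique-∷ (λ { (here x≡y) → x≢y x≡y }) unique-[ _ ]

  unique-∷ʳ : ∀ {xs} {y : A} → Unique xs → y ∉ xs → Unique (xs ++ y ∷ [])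
  unique-∷ʳ u y∉xs = ++⁺ u unique-[ _ ] λ { (y∈xs , here refl) → y∉xs y∈xs }

  unique-++⁻ : ∀ (xs : List A) {ys} → Unique (xs ++ ys) →
               Unique xs × Unique ys × (∀ {z} → z ∈ xs → z ∉ ys)
  unique-++⁻ [] u = [] , u , λ ()
  unique-++⁻ (x ∷ xs) u@(_ ∷ u′) with unique-++⁻ xs u′
  ... | uxs , uys , disjoint =
    unique-∷ (head∉tail u ∘ ∈-++⁺ˡ) uxs , uys ,
    λ { (here refl) → head∉tail u ∘ ∈-++⁺ʳ xs ; (there z∈xs) → disjoint z∈xs }

module Walks {n m : ℕ} (G : Graph n m) where

  private variable
    u v w x y t a b : Fin n
    e g : Fin m
    es fs : List (Fin m)
    vs ws : List (Fin n)

  joins-sym : Joins G e u w → Joins G e w u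
  joins-sym (inj₁ p) = inj₂ p
  joins-sym (inj₂ p) = inj₁ p

  joins-same : Joins G e u w → Joins G e a b → (a ≡ u × b ≡ w) ⊎ (a ≡ w × b ≡ u)
  joins-same (inj₁ p) (inj₁ q) = inj₁ (,-injective (trans (sym q) p))
  joins-same (inj₁ p) (inj₂ q) = inj₂ (swap (,-injective (trans (sym q) p)))
  joins-same (inj₂ p) (inj₁ q) = inj₂ (,-injective (trans (sym q) p))
  joins-same (inj₂ p) (inj₂ q) = inj₁ (swap (,-injective (trans (sym q) p)))

  joins-det : Joins G e u w → Joins G e u y → y ≡ w
  joins-det j j′ with joins-same j j′
  ... | inj₁ (_ , y≡w) = y≡w
  ... | inj₂ (u≡w , y≡u) = trans y≡u u≡w

  start∈ : Walk G u v es vs → u ∈ vs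
  start∈ here = here refl
  start∈ (step _ _) = here refl

  end∈ : Walk G u v es vs → v ∈ vs
  end∈ here = here refl
  end∈ (step _ p) = there (end∈ p)

  edgeless-walk : Walk G u v [] vs → u ≡ v
  edgeless-walk here = refl

  walk-head : Walk G u v es vs → vs ≡ u ∷ drop 1 vs
  walk-head here = refl
  walk-head (step _ _) = refl

  vertices-det : Walk G u v es vs → Walk G u w es ws → vs ≡ ws
  vertices-det here here = refl
  vertices-det (step j p) (step j′ q) with joins-det j j′
  ... | refl = cong (_ ∷_) (vertices-det p q)

  _++ʷ_ : Walk G u v es vs → Walk G v w fs ws → Walk G u w (es ++ fs) (vs ++ drop 1 ws)
  here ++ʷ q rewrite sym (walk-head q) = q
  step j p ++ʷ q = step j (p ++ʷ q)

  edgeWalk : Joins G e u w → Walk G u w (e ∷ []) (u ∷ w ∷ [])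
  edgeWalk j = step j here

  joined-on-walk : Walk G u v es vs → g ∈ es → Joins G g a b → a ∈ vs
  joined-on-walk (step j p) (here refl) j′ with joins-same j j′
  ... | inj₁ (refl , _) = here refl
  ... | inj₂ (refl , _) = there (start∈ p)
  joined-on-walk (step _ p) (there g∈es) j′ = there (joined-on-walk p g∈es j′)

  edges-unique : Walk G u v es vs → Unique vs → Unique es
  edges-unique here _ = []
  edges-unique (step j p) u@(_ ∷ u′) =
    unique-∷ (λ e∈es → head∉tail u (joined-on-walk p e∈es j)) (edges-unique p u′)

  closed-simple-walk : Walk G u u es vs → Unique vs → es ≡ []
  closed-simple-walk here _ = refl
  closed-simple-walk (step _ p) u = ⊥-elim (head∉tail u (end∈ p))

  edge-between-ends : Walk G u v es vs → Unique vs → g ∈ es → Joins G g u v → es ≡ g ∷ []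
  edge-between-ends (step j p) (_ ∷ u′) (here refl) j′ with joins-det j j′
  ... | refl = cong (_ ∷_) (closed-simple-walk p u′)
  edge-between-ends (step _ p) u (there g∈es) j′ = ⊥-elim (head∉tail u (joined-on-walk p g∈es j′))

  record Split (u t v : Fin n) (es : List (Fin m)) (vs : List (Fin n)) : Set where
    field
      es₁ es₂ : List (Fin m)
      vs₁ ws₂ : List (Fin n)
      prefix : Walk G u t es₁ vs₁
      suffix : Walk G t v es₂ (t ∷ ws₂)
      edges-split : es ≡ es₁ ++ es₂
      verts-split : vs ≡ vs₁ ++ ws₂

  split-at : Walk G u v es vs → t ∈ vs → Split u t v es vs
  split-at here (here refl) = record
    { es₁ = [] ; es₂ = [] ; vs₁ = _ ∷ [] ; ws₂ = []
    ; prefix = here ; suffix = here ; edges-split = refl ; verts-split = refl }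
  split-at (step j p) (here refl) = record
    { es₁ = [] ; es₂ = _ ; vs₁ = _ ∷ [] ; ws₂ = _
    ; prefix = here ; suffix = step j p ; edges-split = refl ; verts-split = refl }
  split-at (step j p) (there t∈vs) = record
    { es₁ = _ ∷ es₁ ; es₂ = es₂ ; vs₁ = _ ∷ vs₁ ; ws₂ = ws₂
    ; prefix = step j prefix ; suffix = suffix
    ; edges-split = cong (_ ∷_) edges-split ; verts-split = cong (_ ∷_) verts-split }
    where open Split (split-at p t∈vs)

  split-simple : (S : Split u t v es vs) → Unique vs → Unique (Split.vs₁ S) × Unique (t ∷ Split.ws₂ S)
  split-simple S u with unique-++⁻ (Split.vs₁ S) (subst Unique (Split.verts-split S) u)
  ... | u₁ , u₂ , disjoint = u₁ , unique-∷ (disjoint (end∈ (Split.prefix S))) u₂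

  record Path (u v : Fin n) : Set where
    field
      edges : List (Fin m)
      verts : List (Fin n)
      walk : Walk G u v edges verts
      simple : Unique verts
  open Path public

  trivialPath : ∀ x → Path x x
  trivialPath x = record { edges = [] ; verts = x ∷ [] ; walk = here ; simple = unique-[ x ] }

  extend : (P : Path w x) → Joins G e x y → y ∉ verts P → Path w y
  extend P j y∉P = record
    { edges = edges P ++ _ ∷ [] ; verts = verts P ++ _ ∷ []
    ; walk = walk P ++ʷ edgeWalk j ; simple = unique-∷ʳ (simple P) y∉P }

  extend-length : (P : Path w x) (j : Joins G e x y) (y∉P : y ∉ verts P) →
                  length (edges (extend P j y∉P)) ≡ suc (length (edges P))
  extend-length P _ _ = trans (length-++ (edges P)) (+-comm _ 1)

  suffix-path : (P : Path u v) → t ∈ verts P →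
                Σ (Path t v) λ Q → length (edges Q) ≤ length (edges P) × verts Q ⊆ verts P
  suffix-path {u = u} {v = v} {t = t} P t∈P = Q , shorter , subset
    where
    S : Split u t v (edges P) (verts P)
    S = split-at (walk P) t∈P
    open Split S
    Q : Path t v
    Q = record { edges = es₂ ; verts = _ ∷ ws₂ ; walk = suffix ; simple = proj₂ (split-simple S (simple P)) }
    shorter : length es₂ ≤ length (edges P)
    shorter = ≤-trans (m≤n+m _ (length es₁))
                      (≤-reflexive (sym (trans (cong length edges-split) (length-++ es₁))))
    subset : verts Q ⊆ verts P
    subset (here refl) = t∈P
    subset (there z∈ws₂) = subst (_ ∈_) (sym verts-split) (∈-++⁺ʳ vs₁ z∈ws₂)

  shortcut : Walk G u v es vs → Σ (Path u v) λ P → length (edges P) ≤ length es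
  shortcut {u = u} here = trivialPath u , z≤n
  shortcut {u = u} (step j p) with shortcut p
  ... | P , P≤p with any? (u ≟F_) (verts P)
  ...   | no u∉P = record { edges = _ ; verts = _ ; walk = step j (walk P) ; simple = unique-∷ u∉P (simple P) }
                 , s≤s P≤p
  ...   | yes u∈P with suffix-path P u∈P
  ...     | Q , Q≤P , _ = Q , m≤n⇒m≤1+n (≤-trans Q≤P P≤p)

-- In an acyclic graph, simple paths are determined by their ends

module AcyclicGraphs {n m : ℕ} (G : Graph n m) (acyclic : Acyclic G) where
  open Walks G

  private variable
    u v w x y b : Fin n
    e f : Fin m
    es fs : List (Fin m)
    vs ws : List (Fin n)

  -- an edge is not a loop (a loop is a cycle of length one)
  no-self-loop : Joins G e x y → x ≢ y
  no-self-loop j refl = acyclic (_ , _ , [] , _ ∷ [] , edgeWalk j , unique-[ _ ] , unique-[ _ ])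

  -- the only simple path between the ends of an edge e is e itself:
  -- any other one, closed up by e, would be a cycle
  edge-is-only-path : Joins G e u w → Walk G u w (f ∷ fs) vs → Unique vs → f ≡ e
  edge-is-only-path {e = e} {f = f} {fs = fs} j p up with any? (e ≟F_) (f ∷ fs)
  ... | yes e∈p = ∷-injectiveˡ (edge-between-ends p up e∈p j)
  edge-is-only-path {u = u} {f = f} {fs = fs} j p@(step {vs = vs₁} j₁ p₁) up@(_ ∷ up′) | no e∉p =
    ⊥-elim (acyclic (u , f , fs ++ _ ∷ [] , vs₁ ++ u ∷ [] , step j₁ (p₁ ++ʷ edgeWalk (joins-sym j)) ,
                     unique-∷ʳ (edges-unique p up) e∉p , unique-∷ʳ up′ (head∉tail up)))

  -- any two simple paths with the same ends use the same edges; by induction,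
  -- using that they leave the start along the same edge
  mutual
    simple-paths-unique : Walk G u v es vs → Unique vs → Walk G u v fs ws → Unique ws → es ≡ fs
    simple-paths-unique here _ q uq = sym (closed-simple-walk q uq)
    simple-paths-unique (step _ p) up here _ = ⊥-elim (head∉tail up (end∈ p))
    simple-paths-unique (step j p) up@(_ ∷ up′) (step j′ q) uq@(_ ∷ uq′)
      with first-edges-agree j p up (step j′ q) uq
    ... | refl with joins-det j j′
    ...   | refl = cong (_ ∷_) (simple-paths-unique p up′ q uq′)

    -- two simple paths from u to v leave u along the same edge: otherwise the
    -- second path returns to the second vertex w of the first one, and the
    -- part before w together with the edge uw forms a cycle
    first-edges-agree : Joins G e u w → Walk G w v es vs → Unique (u ∷ vs) →
                        Walk G u v (f ∷ fs) ws → Unique ws → e ≡ f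
    first-edges-agree {w = w} {ws = ws} j p up q uq with any? (w ≟F_) ws
    ... | yes w∈q with split-at q w∈q | split-simple (split-at q w∈q) uq
    ...   | record { es₁ = [] ; prefix = here } | _ = ⊥-elim (head∉tail up (start∈ p))
    ...   | record { es₁ = f₁ ∷ _ ; prefix = pre ; edges-split = q≡ } | upre , _ =
      trans (sym (edge-is-only-path j pre upre)) (sym (∷-injectiveˡ q≡))
    first-edges-agree {e = e} {w = w} {v = v} {vs = vs} {f = f} {fs = fs} {ws = ws} j p up@(_ ∷ up′) q uq | no w∉q =
      ⊥-elim (head∉tail up (subst (_ ∈_) (sym p-vertices) (there (start∈ q))))
      where
      -- if w is not on the second path, stepping back from w to u and then
      -- following it is a second simple path from w, and p must be that path
      back : Walk G w v (e ∷ f ∷ fs) (w ∷ ws)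
      back = step (joins-sym j) q
      p-vertices : vs ≡ w ∷ ws
      p-vertices = vertices-det (subst (λ es → Walk G w v es vs)
                                       (simple-paths-unique p up′ back (unique-∷ w∉q uq)) p) back

  same-path : (P Q : Path u v) → edges P ≡ edges Q × verts P ≡ verts Q
  same-path P Q = edges≡ , vertices-det (subst (λ es → Walk G _ _ es (verts P)) edges≡ (walk P)) (walk Q)
    where
    edges≡ : edges P ≡ edges Q
    edges≡ = simple-paths-unique (walk P) (simple P) (walk Q) (simple Q)

  -- a simple path ending at u and avoiding the neighbour x of u meets no other
  -- neighbour b of x: from b, both the edge bx and the path back to u followed
  -- by ux would be simple paths to x
  other-neighbour-off-path : Joins G e u x → Joins G f x b → (P : Path w u) →
                             x ∉ verts P → b ∈ verts P → b ≡ u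
  other-neighbour-off-path {e = e} {f = f} j₁ j₂ P x∉P b∈P with suffix-path P b∈P
  ... | Q , _ , Q⊆P = edgeless-walk (subst (λ es → Walk G _ _ es _) no-edges (walk Q))
    where
    one-edge : edges Q ++ e ∷ [] ≡ f ∷ []
    one-edge = simple-paths-unique (walk Q ++ʷ edgeWalk j₁) (unique-∷ʳ (simple Q) (x∉P ∘ Q⊆P))
                                   (edgeWalk (joins-sym j₂)) (unique-pair (no-self-loop j₂ ∘ sym))
    no-edges : edges Q ≡ []
    no-edges = ∷ʳ-injectiveˡ (edges Q) [] one-edge

  -- a simple path is a shortest walk between its ends, so it is no longer than the diameter
  simple-path-≤-diameter : ∀ D → IsDiameter G D → Walk G u v es vs → Unique vs → length es ≤ D
  simple-path-≤-diameter {u = u} {v = v} {es = es} {vs = vs} D diam p up =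
    proj₂ diam u v (length es) ((es , vs , p , refl) , shortest)
    where
    shortest : ∀ fs ws → Walk G u v fs ws → length es ≤ length fs
    shortest fs ws q with shortcut q
    ... | Q , Q≤q = subst (λ es′ → length es′ ≤ length fs)
                          (sym (simple-paths-unique p up (walk Q) (simple Q))) Q≤q

labelPair : ℕ → ℕ → List ℕ
labelPair a b with a ≟ℕ b
... | yes _ = a ∷ []
... | no _ = a ∷ b ∷ []

module _ {a b : ℕ} where

  labelPair-∈ˡ : a ∈ labelPair a b
  labelPair-∈ˡ with a ≟ℕ b
  ... | yes _ = here refl
  ... | no _ = here refl

  labelPair-∈ʳ : b ∈ labelPair a b
  labelPair-∈ʳ with a ≟ℕ b
  ... | yes a≡b = here (sym a≡b)
  ... | no _ = there (here refl)

  labelPair-∈⁻ : ∀ {l} → l ∈ labelPair a b → l ≡ a ⊎ l ≡ b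
  labelPair-∈⁻ l∈ with a ≟ℕ b | l∈
  ... | yes _ | here l≡a = inj₁ l≡a
  ... | no _ | here l≡a = inj₁ l≡a
  ... | no _ | there (here l≡b) = inj₂ l≡b

  labelPair-unique : Unique (labelPair a b)
  labelPair-unique with a ≟ℕ b
  ... | yes _ = unique-[ a ]
  ... | no a≢b = unique-pair a≢b

  labelPair-size : length (labelPair a b) ≤ 2
  labelPair-size with a ≟ℕ b
  ... | yes _ = s≤s z≤n
  ... | no _ = s≤s (s≤s z≤n)

age-bound : ∀ {m} (lab : Labeling m) D → (∀ e {l} → l ∈ lab e → l < D) → age lab ≤ D
age-bound {m} lab D below with allLabels lab in labels≡
... | [] = z≤n
... | l₀ ∷ ls = ≤-trans (s≤s (m∸n≤m (foldr _⊔_ l₀ ls) (foldr _⊓_ l₀ ls)))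
                      (foldr-preservesᵇ ⊔-lub (used-below (here refl)) (tabulate (used-below ∘ there)))
  where
  used-below : ∀ {l} → l ∈ l₀ ∷ ls → l < D
  used-below l∈ with satisfied (∈-concatMap⁻ lab {xs = allFin m} (subst (_ ∈_) (sym labels≡) l∈))
  ... | e , l∈e = below e l∈e

module _ {n m : ℕ} (G : Graph n m) (lab : Labeling m) (ℓ : Fin n → Fin n → ℕ)
         (ℓ∈lab : ∀ {e u w} → Joins G e u w → ℓ u w ∈ lab e)
         (ℓ-increases : ∀ {e f u x b} → Joins G e u x → Joins G f x b → u ≢ b → ℓ u x < ℓ x b) where
  open Walks G using (start∈)

  walkLabels : ∀ {u v es vs} → Walk G u v es vs → List ℕ
  walkLabels here = []
  walkLabels (step {u = u} {w = w} _ p) = ℓ u w ∷ walkLabels p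

  all-paths-preserved : AllPaths G lab
  all-paths-preserved _ _ _ (_ , p , up) = walkLabels p , labels∈ p , increasing p up
    where
    labels∈ : ∀ {u v es vs} (p : Walk G u v es vs) → Pointwise (λ l e → l ∈ lab e) (walkLabels p) es
    labels∈ here = []
    labels∈ (step j p) = ℓ∈lab j ∷ labels∈ p
    increasing : ∀ {u v es vs} (p : Walk G u v es vs) → Unique vs → Linked _<_ (walkLabels p)
    increasing here _ = []
    increasing (step _ here) _ = [-]
    increasing (step j₁ (step j₂ p)) up@(_ ∷ up′) =
      ℓ-increases j₁ j₂ (λ { refl → head∉tail up (there (start∈ p)) }) ∷ increasing (step j₂ p) up′

module Heights {n m : ℕ} (G : Graph n m) (acyclic : Acyclic G) (connected : Connected G) where
  open Graph G
  open Walks G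
  open AcyclicGraphs G acyclic

  private variable
    u w x y b : Fin n
    e f : Fin m

  Arm : Fin n → Set
  Arm x = Σ (Fin n) λ w → Path w x

  armLength : Arm x → ℕ
  armLength (_ , P) = length (edges P)

  Avoids : Fin n → Arm x → Set
  Avoids y (_ , P) = y ∉ verts P

  avoids? : ∀ y → Decidable (Avoids {x} y)
  avoids? y (_ , P) = ¬? (any? (y ≟F_) (verts P))

  arm : ∀ w x → Arm x
  arm w x = w , proj₁ (shortcut (proj₂ (proj₂ (connected w x))))

  candidates : ∀ x → Fin n → List (Arm x)
  candidates x y = filter (avoids? y) (map (λ w → arm w x) (allFin n))

  -- a longest arm at x avoiding y (the trivial arm if there is no other)
  longestArm : ∀ x → Fin n → Arm x
  longestArm x y = argmax armLength (x , trivialPath x) (candidates x y)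

  height : Fin n → Fin n → ℕ
  height x y = armLength (longestArm x y)

  -- the trivial arm avoids every y ≠ x, so the chosen longest arm avoids y
  longestArm-avoids : y ≢ x → Avoids y (longestArm x y)
  longestArm-avoids {y = y} {x = x} y≢x =
    argmax-all armLength {P = Avoids y} {xs = candidates x y}
               (λ { (here y≡x) → y≢x y≡x }) (all-filter (avoids? y) (map (λ w → arm w x) (allFin n)))

  height-maximal : (P : Path w x) → y ∉ verts P → length (edges P) ≤ height x y
  height-maximal {w = w} {x = x} {y = y} P y∉P with same-path P (proj₂ (arm w x))
  ... | edges≡ , verts≡ = subst (_≤ height x y) (cong length (sym edges≡)) (lookup longest listed)
    where
    listed : arm w x ∈ candidates x y
    listed = ∈-filter⁺ (avoids? y) (∈-map⁺ (λ w′ → arm w′ x) (∈-allFin w)) (subst (y ∉_) verts≡ y∉P)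
    longest : All (λ a → armLength a ≤ height x y) (candidates x y)
    longest = f[xs]≤f[argmax] {f = armLength} (x , trivialPath x) (candidates x y)

  height-increases : Joins G e u x → Joins G f x b → u ≢ b → height u x < height x b
  height-increases {u = u} {x = x} {b = b} j₁ j₂ u≢b with longestArm u x | longestArm-avoids (no-self-loop j₁ ∘ sym)
  ... | _ , P | x∉P = subst (_≤ height x b) (extend-length P j₁ x∉P) (height-maximal (extend P j₁ x∉P) b∉Px)
    where
    b∉Px : b ∉ verts P ++ x ∷ []
    b∉Px b∈ with ∈-++⁻ (verts P) b∈
    ... | inj₁ b∈P = u≢b (sym (other-neighbour-off-path j₁ j₂ P x∉P b∈P))
    ... | inj₂ (here b≡x) = no-self-loop j₂ (sym b≡x)

  -- a longest arm at x avoiding y, followed by the edge xy, is a simple path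
  height-below-diameter : ∀ D → IsDiameter G D → Joins G e x y → height x y < D
  height-below-diameter {x = x} {y = y} D diam j with longestArm x y | longestArm-avoids (no-self-loop j ∘ sym)
  ... | _ , P | y∉P = subst (_≤ D) (extend-length P j y∉P)
                        (simple-path-≤-diameter D diam (walk (extend P j y∉P)) (simple (extend P j y∉P)))

  heightLabeling : Labeling m
  heightLabeling e = labelPair (height (proj₁ (ends e)) (proj₂ (ends e))) (height (proj₂ (ends e)) (proj₁ (ends e)))

  heightLabeling-unique : IsSetLabeling heightLabeling
  heightLabeling-unique e = labelPair-unique {height (proj₁ (ends e)) (proj₂ (ends e))}

  heightLabeling-size : ∀ e → length (heightLabeling e) ≤ 2
  heightLabeling-size e = labelPair-size {height (proj₁ (ends e)) (proj₂ (ends e))}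

  traversal-label : Joins G e u w → height u w ∈ heightLabeling e
  traversal-label (inj₁ ends≡) rewrite ends≡ = labelPair-∈ˡ
  traversal-label (inj₂ ends≡) rewrite ends≡ = labelPair-∈ʳ

  label-below-diameter : ∀ D → IsDiameter G D → ∀ e {l} → l ∈ heightLabeling e → l < D
  label-below-diameter D diam e l∈ with labelPair-∈⁻ l∈
  ... | inj₁ refl = height-below-diameter D diam (inj₁ refl)
  ... | inj₂ refl = height-below-diameter D diam (inj₂ refl)

theorem5 : ∀ {n m} (T : Graph n m) → IsTree T → (D : ℕ) → IsDiameter T D →
           Σ (Labeling m) λ lab → IsSetLabeling lab × AllPaths T lab ×
             age lab ≤ D × (∀ (e : Fin m) → length (lab e) ≤ 2)
theorem5 T (_ , connected , acyclic) D diam =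
  heightLabeling , heightLabeling-unique ,
  all-paths-preserved T heightLabeling height traversal-label height-increases ,
  age-bound heightLabeling D (label-below-diameter D diam) , heightLabeling-size
  where open Heights T acyclic connected
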